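{- Let $n\ge 1$, $0<p<1$ and $r\ge 1$. Let $\mathbf{D}$ be a random directed graph on the vertex set $\{1,\dots,n\}$ in which each of the $n(n-1)$ possible directed arcs $(i,j)$, $i\neq j$, is present independently with probability $p$. Let $\mathbf{X}$ (resp. $\mathbf{Y}$) be the number of arcs $(i,j)$ of $\mathbf{D}$ with $j>i$ (resp. $i>j$), i.e. the number of 1's above (resp. below) the diagonal of the adjacency matrix of $\mathbf{D}$ in the given vertex numbering. Let $\mathbf{X}^*$ and $\mathbf{Y}^*$ be the numbers of feedforward and feedback arcs in an FAS solution of $\mathbf{D}$. Then $$\Pr\left(\frac{\mathbf{X}^*}{\mathbf{Y}^*}\ge r\right)\le n!\,\Pr\left(\frac{\mathbf{X}}{\mathbf{Y}}\ge r\right).$$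
   Context: For a digraph with vertices numbered $1,\dots,n$, an arc from $i$ to $j$ is called feedforward if $j>i$ and feedback if $j<i$. An FAS solution (solution of the minimal feedback arc set problem) is a renumbering (permutation) of the vertices that minimizes the number of feedback arcs; $\mathbf{Y}^*$ is this minimal number of feedback arcs and $\mathbf{X}^*$ is the number of feedforward arcs in such a renumbering (equal to the total number of arcs minus $\mathbf{Y}^*$). By convention, an inequality of the form $\frac{X}{Y}\ge r$ is defined to be true when $Y=0$.
   Formalization: The arc probability p and the parameter r take rational values. -}

module Defs where

open import Data.Bool using (Bool; true; false; if_then_else_; _∧_; not)
open import Data.Nat as ℕ using (ℕ; zero; suc; _<ᵇ_; _≡ᵇ_; _⊓_)
open import Data.Fin using (Fin; toℕ)
open import Data.Fin.Properties using (_≟_)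
open import Data.List using (List; []; _∷_; concatMap; map; filter; length; foldr; allFin)
open import Data.Bool.ListAction using (and)
open import Data.Product using (_×_; _,_)
open import Data.Vec as Vec using (Vec; lookup)
open import Data.Integer using (+_)
open import Data.Rational using (ℚ; 0ℚ; 1ℚ; _+_; _*_; _-_; _/_; _≤ᵇ_)
open import Relation.Nullary.Decidable using (⌊_⌋; ¬?)

offDiag : (n : ℕ) → List (Fin n × Fin n)
offDiag n = concatMap (λ i → map (λ j → (i , j)) (filter (λ j → ¬? (i ≟ j)) (allFin n))) (allFin n)

record Digraph (n : ℕ) : Set where
  constructor mkDigraph
  field
    arcPresent : Vec Bool (length (offDiag n))

open Digraph public

allBoolVecs : (m : ℕ) → List (Vec Bool m)
allBoolVecs zero = Vec.[] ∷ []
allBoolVecs (suc m) = concatMap (λ v → (true Vec.∷ v) ∷ (false Vec.∷ v) ∷ []) (allBoolVecs m)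

allDigraphs : (n : ℕ) → List (Digraph n)
allDigraphs n = map mkDigraph (allBoolVecs (length (offDiag n)))

select : {A : Set} → List A → {m : ℕ} → Vec Bool m → List A
select (a ∷ as) (true Vec.∷ bs) = a ∷ select as bs
select (a ∷ as) (false Vec.∷ bs) = select as bs
select _ _ = []

arcs : {n : ℕ} → Digraph n → List (Fin n × Fin n)
arcs {n} D = select (offDiag n) (arcPresent D)

numArcs : {n : ℕ} → Digraph n → ℕ
numArcs D = length (arcs D)

count : {A : Set} → (A → Bool) → List A → ℕ
count P xs = length (filter (λ x → Data.Bool._≟_ (P x) true) xs)
  where import Data.Bool

-- A renumbering: vertex i receives new number σ i; must be a bijection of Fin n.
Renumbering : ℕ → Set
Renumbering n = Vec (Fin n) n

isPermutation : {n : ℕ} → Renumbering n → Bool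
isPermutation {n} σ =
  and (map (λ p → let (i , j) = p in not ⌊ lookup σ i ≟ lookup σ j ⌋) (offDiag n))

allVecs : (n k : ℕ) → List (Vec (Fin n) k)
allVecs n zero = Vec.[] ∷ []
allVecs n (suc k) = concatMap (λ v → map (λ x → x Vec.∷ v) (allFin n)) (allVecs n k)

allRenumberings : (n : ℕ) → List (Renumbering n)
allRenumberings n = filter (λ σ → Data.Bool._≟_ (isPermutation σ) true) (allVecs n n)
  where import Data.Bool

feedforward : {n : ℕ} → Renumbering n → Digraph n → ℕ
feedforward σ D = count (λ p → let (i , j) = p in toℕ (lookup σ i) <ᵇ toℕ (lookup σ j)) (arcs D)

feedback : {n : ℕ} → Renumbering n → Digraph n → ℕ
feedback σ D = count (λ p → let (i , j) = p in toℕ (lookup σ j) <ᵇ toℕ (lookup σ i)) (arcs D)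

Xof : {n : ℕ} → Digraph n → ℕ
Xof D = count (λ p → let (i , j) = p in toℕ i <ᵇ toℕ j) (arcs D)

Yof : {n : ℕ} → Digraph n → ℕ
Yof D = count (λ p → let (i , j) = p in toℕ j <ᵇ toℕ i) (arcs D)

minimum : ℕ → List ℕ → ℕ
minimum d [] = d
minimum d (x ∷ xs) = foldr _⊓_ x xs

Ystar : {n : ℕ} → Digraph n → ℕ
Ystar {n} D = minimum (numArcs D) (map (λ σ → feedback σ D) (allRenumberings n))

Xstar : {n : ℕ} → Digraph n → ℕ
Xstar D = numArcs D ℕ.∸ Ystar D

-- "X / Y ≥ r", defined to be true when Y = 0.
ratioGe : ℕ → ℕ → ℚ → Bool
ratioGe X zero r = true
ratioGe X (suc k) r = r ≤ᵇ ((+ X) / suc k)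

pow : ℚ → ℕ → ℚ
pow q zero = 1ℚ
pow q (suc k) = q * pow q k

weight : {n : ℕ} → ℚ → Digraph n → ℚ
weight {n} p D = pow p (numArcs D) * pow (1ℚ - p) (length (offDiag n) ℕ.∸ numArcs D)

Pr : (n : ℕ) → ℚ → (Digraph n → Bool) → ℚ
Pr n p E = foldr _+_ 0ℚ (map (λ D → if E D then weight p D else 0ℚ) (allDigraphs n))

ℕtoℚ : ℕ → ℚ
ℕtoℚ k = (+ k) / 1

{-# OPTIONS --safe #-}
module Submission where

open import Defs
open import Data.Nat using (ℕ; _≤_)
open import Data.Nat using (_!)
open import Data.Rational using (ℚ; 0ℚ; 1ℚ; _<_; _*_) renaming (_≤_ to _≤ℚ_)

open import Algebra.Bundles using (CommutativeMonoid)
open import Data.Bool using (Bool; true; false; not; _∧_; if_then_else_)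
import Data.Bool.Properties as Boolₚ
open import Data.Fin using (Fin; toℕ)
import Data.Fin as Fin
import Data.Fin.Properties as Finₚ
open Finₚ using (_≟_)
open import Data.List using (List; []; _∷_; _++_; map; concatMap; filter; length; foldr; allFin)
import Data.List.Properties as Listₚ
open import Data.List.Membership.Propositional using (_∈_)
open import Data.List.Membership.Propositional.Properties
  using (∈-allFin; ∈-map⁺; ∈-map⁻; ∈-filter⁺; ∈-filter⁻; ∈-concat⁺′; ∈-concat⁻′; foldr-selective)
open import Data.List.Relation.Unary.All as All using (All; []; _∷_)
open import Data.List.Relation.Unary.All.Properties using (all⁺; all⁻)
open import Data.List.Relation.Unary.Any using (here; there)
import Data.Nat as ℕ
import Data.Nat.Properties as ℕₚ
import Data.Nat.Combinatorics as Combinatorics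
open import Data.Nat.Combinatorics.Base using (_P′_)
open import Data.Product using (_×_; _,_; proj₁; proj₂; ∃-syntax; swap)
import Data.Rational as ℚ
import Data.Rational.Properties as ℚₚ
open import Data.Sum using (inj₁; inj₂)
open import Data.Vec as Vec using (Vec; lookup)
import Data.Vec.Properties as Vecₚ
open import Function using (_∘_; id; _⇔_; mk⇔; Equivalence)
open import Function.Definitions using (Injective)
import Relation.Binary.PropositionalEquality as ≡
open ≡ using (_≡_; _≢_)
open import Relation.Binary.Definitions using (DecidableEquality)
open import Relation.Nullary using (Dec; does; yes; no; contradiction)
open import Relation.Nullary.Decidable using (¬?; dec-false; dec⇒maybe; toWitnessFalse; fromWitnessFalse)
open import Tactic.RingSolver using (solve-∀)
open import Tactic.RingSolver.Core.AlmostCommutativeRing using (AlmostCommutativeRing; fromCommutativeRing)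

-- Every digraph D has an optimal renumbering σ, with X* and Y* equal to the numbers X_σ and Y_σ
-- of arcs that σ makes feedforward and feedback; so the event X*/Y* ≥ r is covered by the events
-- X_σ/Y_σ ≥ r, of which there are at most n!.  Each of them is as likely as X/Y ≥ r: for an
-- injective σ, swapping (i , j) ↦ (j , i) shows that exactly half of the n(n-1) possible arcs
-- become feedforward, and under independent Bernoulli(p) arcs the joint law of (X_σ , Y_σ),
-- a pair of independent binomials, depends only on these two numbers of possible arcs.

module ListSum {c ℓ} (M : CommutativeMonoid c ℓ) where
  open CommutativeMonoid M renaming (Carrier to C)
  open import Algebra.Properties.CommutativeSemigroup commutativeSemigroup using (interchange)
  open import Relation.Binary.Reasoning.Setoid setoid

  ∑ : {A : Set} → List A → (A → C) → C
  ∑ xs f = foldr _∙_ ε (map f xs)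

  syntax ∑ xs (λ x → e) = ∑[ x ∈ xs ] e

  module _ {A : Set} where

    ∑-cong : (xs : List A) {f g : A → C} → (∀ {x} → x ∈ xs → f x ≈ g x) → ∑ xs f ≈ ∑ xs g
    ∑-cong [] f≈g = refl
    ∑-cong (x ∷ xs) f≈g = ∙-cong (f≈g (here ≡.refl)) (∑-cong xs (f≈g ∘ there))

    ∑-++ : (xs ys : List A) (f : A → C) → ∑ (xs ++ ys) f ≈ ∑ xs f ∙ ∑ ys f
    ∑-++ [] ys f = sym (identityˡ _)
    ∑-++ (x ∷ xs) ys f = trans (∙-congˡ (∑-++ xs ys f)) (sym (assoc _ _ _))

    ∑-ε : (xs : List A) → ∑[ x ∈ xs ] ε ≈ ε
    ∑-ε [] = refl
    ∑-ε (x ∷ xs) = trans (identityˡ _) (∑-ε xs)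

    ∑-∙ : (xs : List A) (f g : A → C) → ∑[ x ∈ xs ] (f x ∙ g x) ≈ ∑ xs f ∙ ∑ xs g
    ∑-∙ [] f g = sym (identityˡ ε)
    ∑-∙ (x ∷ xs) f g = trans (∙-congˡ (∑-∙ xs f g)) (interchange _ _ _ _)

  ∑-map : {A B : Set} (xs : List A) (g : A → B) (f : B → C) → ∑ (map g xs) f ≈ ∑ xs (f ∘ g)
  ∑-map xs g f = reflexive (≡.cong (foldr _∙_ ε) (≡.sym (Listₚ.map-∘ xs)))

  ∑-concatMap : {A B : Set} (xs : List A) (h : A → List B) (f : B → C) →
    ∑ (concatMap h xs) f ≈ ∑[ x ∈ xs ] ∑ (h x) f
  ∑-concatMap [] h f = refl
  ∑-concatMap (x ∷ xs) h f = trans (∑-++ (h x) (concatMap h xs) f) (∙-congˡ (∑-concatMap xs h f))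

  ∑-comm : {A B : Set} (xs : List A) (ys : List B) (f : A → B → C) →
    ∑[ x ∈ xs ] ∑[ y ∈ ys ] f x y ≈ ∑[ y ∈ ys ] ∑[ x ∈ xs ] f x y
  ∑-comm [] ys f = sym (∑-ε ys)
  ∑-comm (x ∷ xs) ys f = begin
    ∑[ y ∈ ys ] f x y ∙ ∑[ x ∈ xs ] ∑[ y ∈ ys ] f x y  ≈⟨ ∙-congˡ (∑-comm xs ys f) ⟩
    ∑[ y ∈ ys ] f x y ∙ ∑[ y ∈ ys ] ∑[ x ∈ xs ] f x y  ≈⟨ sym (∑-∙ ys (f x) _) ⟩
    ∑[ y ∈ ys ] (f x y ∙ ∑[ x ∈ xs ] f x y)            ∎

open ≡ using (refl; sym; trans; cong; cong₂; subst; module ≡-Reasoning)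

private
  variable
    A B : Set

count-++ : (P : A → Bool) (xs ys : List A) → count P (xs ++ ys) ≡ count P xs ℕ.+ count P ys
count-++ P [] ys = refl
count-++ P (x ∷ xs) ys with P x
... | true = cong ℕ.suc (count-++ P xs ys)
... | false = count-++ P xs ys

count-map : (P : B → Bool) (f : A → B) (xs : List A) → count P (map f xs) ≡ count (P ∘ f) xs
count-map P f [] = refl
count-map P f (x ∷ xs) with P (f x)
... | true = cong ℕ.suc (count-map P f xs)
... | false = count-map P f xs

count-filter : (P : A → Bool) {Q : A → Set} (Q? : ∀ x → Dec (Q x)) (xs : List A) →
  count P (filter Q? xs) ≡ count (λ x → does (Q? x) ∧ P x) xs
count-filter P Q? [] = refl
count-filter P Q? (x ∷ xs) with does (Q? x)
... | false = count-filter P Q? xs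
... | true with P x
...   | true = cong ℕ.suc (count-filter P Q? xs)
...   | false = count-filter P Q? xs

count-congᴬ : {P Q : A → Bool} {xs : List A} → All (λ x → P x ≡ Q x) xs → count P xs ≡ count Q xs
count-congᴬ [] = refl
count-congᴬ {P = P} {Q} {x ∷ xs} (Px≡Qx ∷ eqs) rewrite Px≡Qx with Q x
... | true = cong ℕ.suc (count-congᴬ eqs)
... | false = count-congᴬ eqs

count-all : {P : A → Bool} (xs : List A) → (∀ x → P x ≡ true) → count P xs ≡ length xs
count-all [] _ = refl
count-all {P = P} (x ∷ xs) all-P rewrite all-P x = cong ℕ.suc (count-all xs all-P)

count-none : {P : A → Bool} (xs : List A) → (∀ x → P x ≡ false) → count P xs ≡ 0
count-none [] _ = refl
count-none {P = P} (x ∷ xs) no-P rewrite no-P x = count-none xs no-P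

count-mono : {P Q : A → Bool} (xs : List A) → (∀ x → P x ≡ true → Q x ≡ true) → count P xs ≤ count Q xs
count-mono [] _ = ℕ.z≤n
count-mono {P = P} {Q} (x ∷ xs) P⇒Q with P x in Px | Q x in Qx
... | true | true = ℕ.s≤s (count-mono xs P⇒Q)
... | false | true = ℕₚ.m≤n⇒m≤1+n (count-mono xs P⇒Q)
... | false | false = count-mono xs P⇒Q
... | true | false with () ← trans (sym Qx) (P⇒Q x Px)

count+count-not : (P : A → Bool) (xs : List A) → count P xs ℕ.+ count (not ∘ P) xs ≡ length xs
count+count-not P [] = refl
count+count-not P (x ∷ xs) with P x
... | true = cong ℕ.suc (count+count-not P xs)
... | false = trans (ℕₚ.+-suc _ _) (cong ℕ.suc (count+count-not P xs))

count-concatMap-≤ : {P : B → Bool} {Q : A → Bool} (h : A → List B) (c : ℕ) →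
  (∀ x → count P (h x) ≤ (if Q x then c else 0)) →
  (xs : List A) → count P (concatMap h xs) ≤ c ℕ.* count Q xs
count-concatMap-≤ h c bound [] = ℕ.z≤n
count-concatMap-≤ {P = P} {Q} h c bound (x ∷ xs)
  rewrite count-++ P (h x) (concatMap h xs) with Q x | bound x
... | true | hx≤c = ℕₚ.≤-trans (ℕₚ.+-mono-≤ hx≤c (count-concatMap-≤ h c bound xs))
                               (ℕₚ.≤-reflexive (sym (ℕₚ.*-suc c _)))
... | false | hx≤0 = ℕₚ.+-mono-≤ hx≤0 (count-concatMap-≤ h c bound xs)

count-exclude-< : (_≟ᴬ_ : DecidableEquality A) {P : A → Bool} {y : A} (xs : List A) → y ∈ xs → P y ≡ true →
  count (λ x → not (does (x ≟ᴬ y)) ∧ P x) xs ℕ.< count P xs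
count-exclude-< _≟ᴬ_ {P = P} {y} (y ∷ xs) (here refl) Py rewrite Py with y ≟ᴬ y
... | yes _ = ℕ.s≤s (count-mono xs (λ x → Boolₚ.∧-conicalʳ _ (P x)))
... | no y≢y = contradiction refl y≢y
count-exclude-< _≟ᴬ_ {P = P} {y} (x ∷ xs) (there y∈xs) Py with x ≟ᴬ y | P x
... | yes _ | true = ℕₚ.m≤n⇒m≤1+n (count-exclude-< _≟ᴬ_ xs y∈xs Py)
... | yes _ | false = count-exclude-< _≟ᴬ_ xs y∈xs Py
... | no _ | true = ℕ.s≤s (count-exclude-< _≟ᴬ_ xs y∈xs Py)
... | no _ | false = count-exclude-< _≟ᴬ_ xs y∈xs Py

All-select : {P : A → Set} (xs : List A) (v : Vec Bool (length xs)) → All P xs → All P (select xs v)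
All-select [] Vec.[] [] = []
All-select (x ∷ xs) (true Vec.∷ v) (px ∷ pxs) = px ∷ All-select xs v pxs
All-select (x ∷ xs) (false Vec.∷ v) (px ∷ pxs) = All-select xs v pxs

length-select : (xs : List A) (v : Vec Bool (length xs)) → length (select xs v) ≤ length xs
length-select [] Vec.[] = ℕ.z≤n
length-select (x ∷ xs) (true Vec.∷ v) = ℕ.s≤s (length-select xs v)
length-select (x ∷ xs) (false Vec.∷ v) = ℕₚ.m≤n⇒m≤1+n (length-select xs v)

minimum-attained : ∀ d (f : A → ℕ) {xs : List A} {y : A} → y ∈ xs →
  ∃[ x ] x ∈ xs × minimum d (map f xs) ≡ f x
minimum-attained d f {x ∷ xs} _ with foldr-selective ℕₚ.⊓-sel (f x) (map f xs)
... | inj₁ min≡fx = x , here refl , min≡fx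
... | inj₂ min∈ with ∈-map⁻ f min∈
...   | z , z∈xs , min≡fz = z , there z∈xs , min≡fz

-- Off-diagonal pairs

module _ {n : ℕ} where

  Loopless : List (Fin n × Fin n) → Set
  Loopless = All (λ x → proj₁ x ≢ proj₂ x)

  private
    row : Fin n → List (Fin n × Fin n)
    row i = map (i ,_) (filter (λ j → ¬? (i ≟ j)) (allFin n))

  ∈-offDiag⁻ : {x : Fin n × Fin n} → x ∈ offDiag n → proj₁ x ≢ proj₂ x
  ∈-offDiag⁻ x∈ with ∈-concat⁻′ (map row (allFin n)) x∈
  ... | _ , x∈row , row∈ with ∈-map⁻ row row∈
  ... | i , _ , refl with ∈-map⁻ (i ,_) x∈row
  ... | j , j∈ , refl = proj₂ (∈-filter⁻ (λ j → ¬? (i ≟ j)) {xs = allFin n} j∈)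

  ∈-offDiag⁺ : {i j : Fin n} → i ≢ j → (i , j) ∈ offDiag n
  ∈-offDiag⁺ {i} {j} i≢j = ∈-concat⁺′
    (∈-map⁺ (i ,_) (∈-filter⁺ (λ j → ¬? (i ≟ j)) (∈-allFin j) i≢j))
    (∈-map⁺ row (∈-allFin i))

  offDiag-loopless : Loopless (offDiag n)
  offDiag-loopless = All.tabulate ∈-offDiag⁻

  arcs-loopless : (D : Digraph n) → Loopless (arcs D)
  arcs-loopless D = All-select (offDiag n) (arcPresent D) offDiag-loopless

  does-≟-sym : (i j : Fin n) → does (i ≟ j) ≡ does (j ≟ i)
  does-≟-sym i j with i ≟ j | j ≟ i
  ... | yes _ | yes _ = refl
  ... | no _ | no _ = refl
  ... | yes i≡j | no j≢i = contradiction (sym i≡j) j≢i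
  ... | no i≢j | yes j≡i = contradiction (sym j≡i) i≢j

  count-offDiag-swap : (P : Fin n × Fin n → Bool) → count P (offDiag n) ≡ count (P ∘ swap) (offDiag n)
  count-offDiag-swap P = begin
    count P (offDiag n)                                         ≡⟨ count-offDiag P ⟩
    ∑[ i ∈ allFin n ] ∑[ j ∈ allFin n ] 𝟙 (i ≢ᵇ j ∧ P (i , j))  ≡⟨ ∑-comm (allFin n) (allFin n) _ ⟩
    ∑[ j ∈ allFin n ] ∑[ i ∈ allFin n ] 𝟙 (i ≢ᵇ j ∧ P (i , j))
      ≡⟨ ∑-cong (allFin n) (λ {j} _ → ∑-cong (allFin n) (λ {i} _ →
           cong (λ b → 𝟙 (not b ∧ P (i , j))) (does-≟-sym i j))) ⟩
    ∑[ j ∈ allFin n ] ∑[ i ∈ allFin n ] 𝟙 (j ≢ᵇ i ∧ P (i , j))  ≡⟨ count-offDiag (P ∘ swap) ⟨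
    count (P ∘ swap) (offDiag n)                                ∎
    where
    open ListSum ℕₚ.+-0-commutativeMonoid
    open ≡-Reasoning

    𝟙 : Bool → ℕ
    𝟙 b = if b then 1 else 0

    _≢ᵇ_ : Fin n → Fin n → Bool
    i ≢ᵇ j = not (does (i ≟ j))

    count≡∑ : (Q : A → Bool) (xs : List A) → count Q xs ≡ ∑[ x ∈ xs ] 𝟙 (Q x)
    count≡∑ Q [] = refl
    count≡∑ Q (x ∷ xs) with Q x
    ... | true = cong ℕ.suc (count≡∑ Q xs)
    ... | false = count≡∑ Q xs

    count-concatMap : (Q : B → Bool) (h : A → List B) (xs : List A) →
      count Q (concatMap h xs) ≡ ∑[ x ∈ xs ] count Q (h x)
    count-concatMap Q h [] = refl
    count-concatMap Q h (x ∷ xs) =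
      trans (count-++ Q (h x) (concatMap h xs)) (cong (count Q (h x) ℕ.+_) (count-concatMap Q h xs))

    count-offDiag : (Q : Fin n × Fin n → Bool) →
      count Q (offDiag n) ≡ ∑[ i ∈ allFin n ] ∑[ j ∈ allFin n ] 𝟙 (i ≢ᵇ j ∧ Q (i , j))
    count-offDiag Q = trans (count-concatMap Q row (allFin n)) (∑-cong (allFin n) λ {i} _ → begin
      count Q (row i)                                  ≡⟨ count-map Q (i ,_) (filter (λ j → ¬? (i ≟ j)) (allFin n)) ⟩
      count (λ j → Q (i , j)) (filter (λ j → ¬? (i ≟ j)) (allFin n))
                                                       ≡⟨ count-filter _ (λ j → ¬? (i ≟ j)) (allFin n) ⟩
      count (λ j → i ≢ᵇ j ∧ Q (i , j)) (allFin n)      ≡⟨ count≡∑ _ (allFin n) ⟩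
      ∑[ j ∈ allFin n ] 𝟙 (i ≢ᵇ j ∧ Q (i , j))          ∎)

rises : ∀ {n} → (Fin n → Fin n) → Fin n × Fin n → Bool
rises f (i , j) = toℕ (f i) ℕ.<ᵇ toℕ (f j)

<ᵇ-flip : ∀ {m n} → m ≢ n → (n ℕ.<ᵇ m) ≡ not (m ℕ.<ᵇ n)
<ᵇ-flip {ℕ.zero} {ℕ.zero} 0≢0 = contradiction refl 0≢0
<ᵇ-flip {ℕ.zero} {ℕ.suc n} _ = refl
<ᵇ-flip {ℕ.suc m} {ℕ.zero} _ = refl
<ᵇ-flip {ℕ.suc m} {ℕ.suc n} m+1≢n+1 = <ᵇ-flip (m+1≢n+1 ∘ cong ℕ.suc)

module _ {n : ℕ} {f : Fin n → Fin n} (f-injective : Injective _≡_ _≡_ f) where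

  count-falls : (xs : List (Fin n × Fin n)) → Loopless xs → count (rises f ∘ swap) xs ≡ count (not ∘ rises f) xs
  count-falls xs loopless =
    count-congᴬ (All.map (λ i≢j → <ᵇ-flip (i≢j ∘ f-injective ∘ Finₚ.toℕ-injective)) loopless)

  count-rises+count-rises : count (rises f) (offDiag n) ℕ.+ count (rises f) (offDiag n) ≡ length (offDiag n)
  count-rises+count-rises = begin
    #rises ℕ.+ #rises                                   ≡⟨ cong (#rises ℕ.+_) (count-offDiag-swap (rises f)) ⟩
    #rises ℕ.+ count (rises f ∘ swap) (offDiag n)       ≡⟨ cong (#rises ℕ.+_) (count-falls (offDiag n) offDiag-loopless) ⟩
    #rises ℕ.+ count (not ∘ rises f) (offDiag n)        ≡⟨ count+count-not (rises f) (offDiag n) ⟩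
    length (offDiag n)                                  ∎
    where
    open ≡-Reasoning
    #rises : ℕ
    #rises = count (rises f) (offDiag n)

count-rises-offDiag : ∀ {n} {f : Fin n → Fin n} → Injective _≡_ _≡_ f →
  count (rises f) (offDiag n) ≡ count (rises id) (offDiag n)
count-rises-offDiag {n} {f} f-injective = begin
  count (rises f) (offDiag n)                                ≡⟨ ℕₚ.n≡⌊n+n/2⌋ _ ⟩
  ℕ.⌊ count (rises f) (offDiag n) ℕ.+ count (rises f) (offDiag n) /2⌋
                                                             ≡⟨ cong ℕ.⌊_/2⌋ (count-rises+count-rises f-injective) ⟩
  ℕ.⌊ length (offDiag n) /2⌋                                 ≡⟨ cong ℕ.⌊_/2⌋ (count-rises+count-rises {n} id) ⟨
  ℕ.⌊ count (rises id) (offDiag n) ℕ.+ count (rises id) (offDiag n) /2⌋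
                                                             ≡⟨ ℕₚ.n≡⌊n+n/2⌋ _ ⟨
  count (rises id) (offDiag n)                               ∎
  where open ≡-Reasoning

-- Renumberings

isPermutation⇔injective : ∀ {n} (σ : Renumbering n) → isPermutation σ ≡ true ⇔ Injective _≡_ _≡_ (lookup σ)
isPermutation⇔injective {n} σ = mk⇔ isPermutation⇒injective injective⇒isPermutation
  where
  isPermutation⇒injective : isPermutation σ ≡ true → Injective _≡_ _≡_ (lookup σ)
  isPermutation⇒injective perm {i} {j} σi≡σj with i ≟ j
  ... | yes i≡j = i≡j
  ... | no i≢j = contradiction σi≡σj
    (toWitnessFalse (All.lookup (all⁺ _ (offDiag n) (Equivalence.from Boolₚ.T-≡ perm)) (∈-offDiag⁺ i≢j)))

  injective⇒isPermutation : Injective _≡_ _≡_ (lookup σ) → isPermutation σ ≡ true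
  injective⇒isPermutation σ-injective = Equivalence.to Boolₚ.T-≡
    (all⁻ _ (All.tabulate (λ x∈ → fromWitnessFalse (∈-offDiag⁻ x∈ ∘ σ-injective))))

∈-allVecs : ∀ {n k} (v : Vec (Fin n) k) → v ∈ allVecs n k
∈-allVecs Vec.[] = here refl
∈-allVecs {n} (x Vec.∷ v) =
  ∈-concat⁺′ (∈-map⁺ (Vec._∷ v) (∈-allFin x)) (∈-map⁺ (λ v → map (Vec._∷ v) (allFin n)) (∈-allVecs v))

∈-allRenumberings : ∀ {n} (σ : Renumbering n) → σ ∈ allRenumberings n ⇔ Injective _≡_ _≡_ (lookup σ)
∈-allRenumberings {n} σ = mk⇔
  (Equivalence.to (isPermutation⇔injective σ) ∘ proj₂ ∘ ∈-filter⁻ isPermutation? {xs = allVecs n n})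
  (∈-filter⁺ isPermutation? (∈-allVecs σ) ∘ Equivalence.from (isPermutation⇔injective σ))
  where
  isPermutation? : (τ : Renumbering n) → Dec (isPermutation τ ≡ true)
  isPermutation? τ = isPermutation τ Boolₚ.≟ true

identity∈allRenumberings : ∀ n → Vec.allFin n ∈ allRenumberings n
identity∈allRenumberings n = Equivalence.from (∈-allRenumberings (Vec.allFin n))
  (λ {i} {j} eq → trans (sym (Vecₚ.lookup-allFin i)) (trans eq (Vecₚ.lookup-allFin j)))

module _ {n : ℕ} where

  fresh : ∀ {k} → Fin n → Vec (Fin n) k → Bool
  fresh x Vec.[] = true
  fresh x (y Vec.∷ v) = not (does (x ≟ y)) ∧ fresh x v

  distinct : ∀ {k} → Vec (Fin n) k → Bool
  distinct Vec.[] = true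
  distinct (x Vec.∷ v) = fresh x v ∧ distinct v

  fresh-∉ : ∀ {k} {x : Fin n} (v : Vec (Fin n) k) → (∀ i → x ≢ lookup v i) → fresh x v ≡ true
  fresh-∉ Vec.[] _ = refl
  fresh-∉ {x = x} (y Vec.∷ v) x∉ =
    cong₂ _∧_ (cong not (dec-false (x ≟ y) (x∉ Fin.zero))) (fresh-∉ v (x∉ ∘ Fin.suc))

  injective⇒distinct : ∀ {k} (v : Vec (Fin n) k) → Injective _≡_ _≡_ (lookup v) → distinct v ≡ true
  injective⇒distinct Vec.[] _ = refl
  injective⇒distinct (x Vec.∷ v) inj =
    cong₂ _∧_ (fresh-∉ v (λ i → Finₚ.0≢1+n ∘ inj)) (injective⇒distinct v (Finₚ.suc-injective ∘ inj))

  count-fresh : ∀ {k} (v : Vec (Fin n) k) → distinct v ≡ true → count (λ x → fresh x v) (allFin n) ℕ.+ k ≤ n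
  count-fresh Vec.[] _ = ℕₚ.≤-reflexive (begin
    count (λ _ → true) (allFin n) ℕ.+ 0  ≡⟨ ℕₚ.+-identityʳ _ ⟩
    count (λ _ → true) (allFin n)       ≡⟨ count-all (allFin n) (λ _ → refl) ⟩
    length (allFin n)                   ≡⟨ Listₚ.length-tabulate id ⟩
    n                                   ∎)
    where open ≡-Reasoning
  count-fresh {ℕ.suc k} (y Vec.∷ v) y∷v-distinct = begin
    count (λ x → fresh x (y Vec.∷ v)) (allFin n) ℕ.+ ℕ.suc k    ≡⟨ ℕₚ.+-suc _ k ⟩
    ℕ.suc (count (λ x → fresh x (y Vec.∷ v)) (allFin n)) ℕ.+ k
      ≤⟨ ℕₚ.+-monoˡ-≤ k (count-exclude-< _≟_ (allFin n) (∈-allFin y) (Boolₚ.∧-conicalˡ _ _ y∷v-distinct)) ⟩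
    count (λ x → fresh x v) (allFin n) ℕ.+ k                    ≤⟨ count-fresh v (Boolₚ.∧-conicalʳ _ _ y∷v-distinct) ⟩
    n                                                           ∎
    where open ℕₚ.≤-Reasoning

  count-distinct : ∀ k → count distinct (allVecs n k) ≤ n P′ k
  count-distinct ℕ.zero = ℕₚ.≤-refl
  count-distinct (ℕ.suc k) = ℕₚ.≤-trans
    (count-concatMap-≤ (λ v → map (Vec._∷ v) (allFin n)) (n ℕ.∸ k) extensions (allVecs n k))
    (ℕₚ.*-monoʳ-≤ (n ℕ.∸ k) (count-distinct k))
    where
    extensions : (v : Vec (Fin n) k) →
      count distinct (map (Vec._∷ v) (allFin n)) ≤ (if distinct v then n ℕ.∸ k else 0)
    extensions v rewrite count-map distinct (Vec._∷ v) (allFin n) with distinct v in v-distinct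
    ... | true = ℕₚ.m+n≤o⇒m≤o∸n _ (ℕₚ.≤-trans
          (ℕₚ.≤-reflexive (cong (ℕ._+ k)
            (count-congᴬ (All.universal (λ x → Boolₚ.∧-identityʳ (fresh x v)) (allFin n)))))
          (count-fresh v v-distinct))
    ... | false = ℕₚ.≤-reflexive (count-none (allFin n) (λ x → Boolₚ.∧-zeroʳ (fresh x v)))

nP′n≡n! : ∀ n → n P′ n ≡ n !
nP′n≡n! n = trans (cong (if_then n P′ n else 0) (sym n≤ᵇn)) (Combinatorics.nPn≡n! n)
  where
  n≤ᵇn : (n ℕ.≤ᵇ n) ≡ true
  n≤ᵇn = Equivalence.to Boolₚ.T-≡ (ℕₚ.≤⇒≤ᵇ (ℕₚ.≤-refl {n}))

length-allRenumberings : ∀ n → length (allRenumberings n) ≤ n !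
length-allRenumberings n = begin
  count isPermutation (allVecs n n)  ≤⟨ count-mono (allVecs n n) permutation⇒distinct ⟩
  count distinct (allVecs n n)       ≤⟨ count-distinct n ⟩
  n P′ n                             ≡⟨ nP′n≡n! n ⟩
  n !                                ∎
  where
  open ℕₚ.≤-Reasoning
  permutation⇒distinct : (σ : Renumbering n) → isPermutation σ ≡ true → distinct σ ≡ true
  permutation⇒distinct σ perm = injective⇒distinct σ (Equivalence.to (isPermutation⇔injective σ) perm)

feedforward+feedback : ∀ {n} {σ : Renumbering n} → Injective _≡_ _≡_ (lookup σ) → (D : Digraph n) →
  feedforward σ D ℕ.+ feedback σ D ≡ numArcs D
feedforward+feedback {σ = σ} σ-injective D =
  trans (cong (feedforward σ D ℕ.+_) (count-falls σ-injective (arcs D) (arcs-loopless D)))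
        (count+count-not (rises (lookup σ)) (arcs D))

optimal-renumbering : ∀ {n} (D : Digraph n) →
  ∃[ σ ] σ ∈ allRenumberings n × Xstar D ≡ feedforward σ D × Ystar D ≡ feedback σ D
optimal-renumbering {n} D
  with minimum-attained (numArcs D) (λ σ → feedback σ D) (identity∈allRenumberings n)
... | σ , σ∈ , Y*≡ = σ , σ∈ , X*≡ , Y*≡
  where
  X*≡ : Xstar D ≡ feedforward σ D
  X*≡ = begin
    numArcs D ℕ.∸ Ystar D                              ≡⟨ cong (numArcs D ℕ.∸_) Y*≡ ⟩
    numArcs D ℕ.∸ feedback σ D
      ≡⟨ cong (ℕ._∸ feedback σ D) (feedforward+feedback {σ = σ} (Equivalence.to (∈-allRenumberings σ) σ∈) D) ⟨
    feedforward σ D ℕ.+ feedback σ D ℕ.∸ feedback σ D  ≡⟨ ℕₚ.m+n∸n≡m (feedforward σ D) (feedback σ D) ⟩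
    feedforward σ D                                    ∎
    where open ≡-Reasoning

-- (+ k) / 1 normalises through a gcd and does not compute, so facts about ℕtoℚ go through ℚᵘ.
module _ where
  open import Data.Rational.Unnormalised as ℚᵘ using (ℚᵘ; mkℚᵘ; *≡*; *≤*)
  import Data.Rational.Unnormalised.Properties as ℚᵘₚ
  import Data.Integer as ℤ
  import Data.Integer.Properties as ℤₚ

  private
    ℕtoℚᵘ : ℕ → ℚᵘ
    ℕtoℚᵘ k = mkℚᵘ (ℤ.+ k) 0

    toℚᵘ-ℕtoℚ : ∀ k → ℚ.toℚᵘ (ℕtoℚ k) ℚᵘ.≃ ℕtoℚᵘ k
    toℚᵘ-ℕtoℚ k = ℚₚ.toℚᵘ-fromℚᵘ (ℕtoℚᵘ k)

  ℕtoℚ-suc : ∀ k → ℕtoℚ (ℕ.suc k) ≡ 1ℚ ℚ.+ ℕtoℚ k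
  ℕtoℚ-suc k = ℚₚ.toℚᵘ-injective (begin
    ℚ.toℚᵘ (ℕtoℚ (ℕ.suc k))            ≈⟨ toℚᵘ-ℕtoℚ (ℕ.suc k) ⟩
    ℕtoℚᵘ (ℕ.suc k)                    ≈⟨ *≡* (trans (ℤₚ.*-identityʳ _) (sym (trans (ℤₚ.*-identityʳ _)
                                             (cong (ℤ._+_ (ℤ.+ 1)) (ℤₚ.*-identityʳ (ℤ.+ k)))))) ⟩
    ℕtoℚᵘ 1 ℚᵘ.+ ℕtoℚᵘ k               ≈⟨ ℚᵘₚ.+-cong (toℚᵘ-ℕtoℚ 1) (toℚᵘ-ℕtoℚ k) ⟨
    ℚ.toℚᵘ 1ℚ ℚᵘ.+ ℚ.toℚᵘ (ℕtoℚ k)      ≈⟨ ℚₚ.toℚᵘ-homo-+ 1ℚ (ℕtoℚ k) ⟨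
    ℚ.toℚᵘ (1ℚ ℚ.+ ℕtoℚ k)             ∎)
    where open ℚᵘₚ.≃-Reasoning

  ℕtoℚ-mono : ∀ {a b} → a ≤ b → ℕtoℚ a ≤ℚ ℕtoℚ b
  ℕtoℚ-mono {a} {b} a≤b = ℚₚ.toℚᵘ-cancel-≤
    (ℚᵘₚ.≤-respˡ-≃ (ℚᵘₚ.≃-sym (toℚᵘ-ℕtoℚ a)) (ℚᵘₚ.≤-respʳ-≃ (ℚᵘₚ.≃-sym (toℚᵘ-ℕtoℚ b))
      (*≤* (≡.subst₂ ℤ._≤_ (sym (ℤₚ.*-identityʳ _)) (sym (ℤₚ.*-identityʳ _)) (ℤ.+≤+ a≤b)))))

*-nonNeg : ∀ {a b} → 0ℚ ≤ℚ a → 0ℚ ≤ℚ b → 0ℚ ≤ℚ a * b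
*-nonNeg {a} {b} 0≤a 0≤b =
  ℚₚ.nonNegative⁻¹ _ {{ℚₚ.nonNeg*nonNeg⇒nonNeg a {{ℚ.nonNegative 0≤a}} b {{ℚ.nonNegative 0≤b}}}}

ℚ-ring : AlmostCommutativeRing _ _
ℚ-ring = fromCommutativeRing ℚₚ.+-*-commutativeRing (λ x → dec⇒maybe (0ℚ ℚₚ.≟ x))

open ListSum ℚₚ.+-0-commutativeMonoid

∑-mono : (xs : List A) {f g : A → ℚ} → (∀ x → f x ≤ℚ g x) → ∑ xs f ≤ℚ ∑ xs g
∑-mono [] _ = ℚₚ.≤-refl
∑-mono (x ∷ xs) f≤g = ℚₚ.+-mono-≤ (f≤g x) (∑-mono xs f≤g)

∑-nonNeg : (xs : List A) {f : A → ℚ} → (∀ x → 0ℚ ≤ℚ f x) → 0ℚ ≤ℚ ∑ xs f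
∑-nonNeg [] _ = ℚₚ.≤-refl
∑-nonNeg (x ∷ xs) f≥0 = ℚₚ.+-mono-≤ (f≥0 x) (∑-nonNeg xs f≥0)

∈⇒≤∑ : {xs : List A} {f : A → ℚ} → (∀ x → 0ℚ ≤ℚ f x) → ∀ {y} → y ∈ xs → f y ≤ℚ ∑ xs f
∈⇒≤∑ {xs = y ∷ xs} {f} f≥0 (here refl) =
  ℚₚ.≤-trans (ℚₚ.≤-reflexive (sym (ℚₚ.+-identityʳ (f y)))) (ℚₚ.+-monoʳ-≤ (f y) (∑-nonNeg xs f≥0))
∈⇒≤∑ {xs = x ∷ xs} {f} f≥0 {y} (there y∈xs) =
  ℚₚ.≤-trans (ℚₚ.≤-reflexive (sym (ℚₚ.+-identityˡ (f y)))) (ℚₚ.+-mono-≤ (f≥0 x) (∈⇒≤∑ f≥0 y∈xs))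

∑-const : (xs : List A) (c : ℚ) → ∑[ _ ∈ xs ] c ≡ ℕtoℚ (length xs) * c
∑-const [] c = sym (ℚₚ.*-zeroˡ c)
∑-const (x ∷ xs) c = begin
  c ℚ.+ ∑[ _ ∈ xs ] c              ≡⟨ cong (c ℚ.+_) (∑-const xs c) ⟩
  c ℚ.+ ℕtoℚ (length xs) * c       ≡⟨ cong (ℚ._+ ℕtoℚ (length xs) * c) (ℚₚ.*-identityˡ c) ⟨
  1ℚ * c ℚ.+ ℕtoℚ (length xs) * c  ≡⟨ ℚₚ.*-distribʳ-+ c 1ℚ (ℕtoℚ (length xs)) ⟨
  (1ℚ ℚ.+ ℕtoℚ (length xs)) * c    ≡⟨ cong (_* c) (ℕtoℚ-suc (length xs)) ⟨
  ℕtoℚ (ℕ.suc (length xs)) * c     ∎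
  where open ≡-Reasoning

-- Independent Bernoulli arcs

module Bernoulli (p : ℚ) where

  q : ℚ
  q = 1ℚ ℚ.- p

  bernoulli : ∀ {m} → Vec Bool m → ℚ
  bernoulli Vec.[] = 1ℚ
  bernoulli (true Vec.∷ v) = p * bernoulli v
  bernoulli (false Vec.∷ v) = q * bernoulli v

  pow-select≡bernoulli : (xs : List A) (v : Vec Bool (length xs)) →
    pow p (length (select xs v)) * pow q (length xs ℕ.∸ length (select xs v)) ≡ bernoulli v
  pow-select≡bernoulli [] Vec.[] = ℚₚ.*-identityˡ 1ℚ
  pow-select≡bernoulli (x ∷ xs) (true Vec.∷ v) =
    trans (ℚₚ.*-assoc p _ _) (cong (p *_) (pow-select≡bernoulli xs v))
  pow-select≡bernoulli (x ∷ xs) (false Vec.∷ v) = begin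
    pow p s * pow q (ℕ.suc (length xs) ℕ.∸ s)
      ≡⟨ cong (λ e → pow p s * pow q e) (ℕₚ.+-∸-assoc 1 (length-select xs v)) ⟩
    pow p s * (q * pow q (length xs ℕ.∸ s))    ≡⟨ ℚₚ.*-comm (pow p s) _ ⟩
    (q * pow q (length xs ℕ.∸ s)) * pow p s    ≡⟨ ℚₚ.*-assoc q _ _ ⟩
    q * (pow q (length xs ℕ.∸ s) * pow p s)    ≡⟨ cong (q *_) (ℚₚ.*-comm _ (pow p s)) ⟩
    q * (pow p s * pow q (length xs ℕ.∸ s))    ≡⟨ cong (q *_) (pow-select≡bernoulli xs v) ⟩
    q * bernoulli v                            ∎
    where
    open ≡-Reasoning
    s : ℕ
    s = length (select xs v)

  bernoulli-nonNeg : 0ℚ ≤ℚ p → p ≤ℚ 1ℚ → ∀ {m} (v : Vec Bool m) → 0ℚ ≤ℚ bernoulli v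
  bernoulli-nonNeg 0≤p p≤1 Vec.[] = ℚₚ.nonNegative⁻¹ 1ℚ
  bernoulli-nonNeg 0≤p p≤1 (true Vec.∷ v) = *-nonNeg 0≤p (bernoulli-nonNeg 0≤p p≤1 v)
  bernoulli-nonNeg 0≤p p≤1 (false Vec.∷ v) = *-nonNeg 0≤q (bernoulli-nonNeg 0≤p p≤1 v)
    where
    0≤q : 0ℚ ≤ℚ q
    0≤q = ℚₚ.≤-trans (ℚₚ.≤-reflexive (sym (ℚₚ.+-inverseʳ p))) (ℚₚ.+-monoˡ-≤ (ℚ.- p) p≤1)

  shift : Bool → (ℕ → ℕ → ℚ) → ℕ → ℕ → ℚ
  shift true g a b = p * g (ℕ.suc a) b ℚ.+ q * g a b
  shift false g a b = p * g a (ℕ.suc b) ℚ.+ q * g a b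

  shift-cong : ∀ c {g h : ℕ → ℕ → ℚ} → (∀ a b → g a b ≡ h a b) → ∀ {a b} → shift c g a b ≡ shift c h a b
  shift-cong true g≗h = cong₂ (λ x y → p * x ℚ.+ q * y) (g≗h _ _) (g≗h _ _)
  shift-cong false g≗h = cong₂ (λ x y → p * x ℚ.+ q * y) (g≗h _ _) (g≗h _ _)

  shift-comm : ∀ g a b → shift false (shift true g) a b ≡ shift true (shift false g) a b
  shift-comm g a b = interchange p q (g (ℕ.suc a) (ℕ.suc b)) (g a (ℕ.suc b)) (g (ℕ.suc a) b) (g a b)
    where
    interchange : ∀ p q x y z w →
      p * (p * x ℚ.+ q * y) ℚ.+ q * (p * z ℚ.+ q * w) ≡ p * (p * x ℚ.+ q * z) ℚ.+ q * (p * y ℚ.+ q * w)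
    interchange = solve-∀ ℚ-ring

  -- expectBinomial k l g a b is the expectation of g (a + K) (b + L) for independent
  -- K ~ Bin(k , p) and L ~ Bin(l , p).
  expectBinomial : ℕ → ℕ → (ℕ → ℕ → ℚ) → ℕ → ℕ → ℚ
  expectBinomial ℕ.zero ℕ.zero g = g
  expectBinomial ℕ.zero (ℕ.suc l) g = shift false (expectBinomial ℕ.zero l g)
  expectBinomial (ℕ.suc k) l g = shift true (expectBinomial k l g)

  expectBinomial-shift-false : ∀ k l g a b →
    expectBinomial k l (shift false g) a b ≡ expectBinomial k (ℕ.suc l) g a b
  expectBinomial-shift-false ℕ.zero ℕ.zero g a b = refl
  expectBinomial-shift-false ℕ.zero (ℕ.suc l) g a b = shift-cong false (expectBinomial-shift-false ℕ.zero l g)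
  expectBinomial-shift-false (ℕ.suc k) l g a b = shift-cong true (expectBinomial-shift-false k l g)

  expectBinomial-shift-true : ∀ k l g a b →
    expectBinomial k l (shift true g) a b ≡ expectBinomial (ℕ.suc k) l g a b
  expectBinomial-shift-true ℕ.zero ℕ.zero g a b = refl
  expectBinomial-shift-true ℕ.zero (ℕ.suc l) g a b =
    trans (shift-cong false (expectBinomial-shift-true ℕ.zero l g)) (shift-comm (expectBinomial ℕ.zero l g) a b)
  expectBinomial-shift-true (ℕ.suc k) l g a b = shift-cong true (expectBinomial-shift-true k l g)

  expectCounts : (xs : List A) → (A → Bool) → (ℕ → ℕ → ℚ) → ℚ
  expectCounts xs P g = ∑[ v ∈ allBoolVecs (length xs) ]
    (bernoulli v * g (count P (select xs v)) (count (not ∘ P) (select xs v)))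

  expectCounts-∷ : ∀ x xs (P : A → Bool) g → expectCounts (x ∷ xs) P g ≡ expectCounts xs P (shift (P x) g)
  expectCounts-∷ x xs P g =
    trans (∑-concatMap (allBoolVecs (length xs)) (λ v → (true Vec.∷ v) ∷ (false Vec.∷ v) ∷ []) _)
          (∑-cong (allBoolVecs (length xs)) (λ {v} _ → condition-on-x v))
    where
    distribute : ∀ p q b y z → (p * b) * y ℚ.+ ((q * b) * z ℚ.+ 0ℚ) ≡ b * (p * y ℚ.+ q * z)
    distribute = solve-∀ ℚ-ring

    condition-on-x : ∀ v →
      (p * bernoulli v) * g (count P (x ∷ select xs v)) (count (not ∘ P) (x ∷ select xs v))
        ℚ.+ ((q * bernoulli v) * g (count P (select xs v)) (count (not ∘ P) (select xs v)) ℚ.+ 0ℚ)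
      ≡ bernoulli v * shift (P x) g (count P (select xs v)) (count (not ∘ P) (select xs v))
    condition-on-x v with P x
    ... | true = distribute p q (bernoulli v) _ _
    ... | false = distribute p q (bernoulli v) _ _

  expectCounts≡expectBinomial : ∀ (xs : List A) P g →
    expectCounts xs P g ≡ expectBinomial (count P xs) (count (not ∘ P) xs) g 0 0
  expectCounts≡expectBinomial [] P g = trans (ℚₚ.+-identityʳ _) (ℚₚ.*-identityˡ (g 0 0))
  expectCounts≡expectBinomial (x ∷ xs) P g rewrite expectCounts-∷ x xs P g with P x
  ... | true = trans (expectCounts≡expectBinomial xs P (shift true g))
                     (expectBinomial-shift-true (count P xs) (count (not ∘ P) xs) g 0 0)
  ... | false = trans (expectCounts≡expectBinomial xs P (shift false g))
                      (expectBinomial-shift-false (count P xs) (count (not ∘ P) xs) g 0 0)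

  expectCounts-cong : ∀ (xs : List A) {P Q} g → count P xs ≡ count Q xs → expectCounts xs P g ≡ expectCounts xs Q g
  expectCounts-cong xs {P} {Q} g #P≡#Q = begin
    expectCounts xs P g                                     ≡⟨ expectCounts≡expectBinomial xs P g ⟩
    expectBinomial (count P xs) (count (not ∘ P) xs) g 0 0  ≡⟨ cong₂ (λ k l → expectBinomial k l g 0 0) #P≡#Q #¬P≡#¬Q ⟩
    expectBinomial (count Q xs) (count (not ∘ Q) xs) g 0 0  ≡⟨ expectCounts≡expectBinomial xs Q g ⟨
    expectCounts xs Q g                                     ∎
    where
    open ≡-Reasoning
    #¬P≡#¬Q : count (not ∘ P) xs ≡ count (not ∘ Q) xs
    #¬P≡#¬Q = ℕₚ.+-cancelˡ-≡ (count P xs) _ _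
      (trans (count+count-not P xs) (sym (trans (cong (ℕ._+ _) #P≡#Q) (count+count-not Q xs))))

  weight≡bernoulli : ∀ {n} (D : Digraph n) → weight p D ≡ bernoulli (arcPresent D)
  weight≡bernoulli {n} D = pow-select≡bernoulli (offDiag n) (arcPresent D)

  weightOn : ∀ {n} → (Digraph n → Bool) → Digraph n → ℚ
  weightOn E D = if E D then weight p D else 0ℚ

  Pr-cong : ∀ {n} {E E′ : Digraph n → Bool} → (∀ D → E D ≡ E′ D) → Pr n p E ≡ Pr n p E′
  Pr-cong {n} E≗E′ = ∑-cong (allDigraphs n) (λ {D} _ → cong (λ b → if b then weight p D else 0ℚ) (E≗E′ D))

  Pr≡expectCounts : ∀ {n} (P : Fin n × Fin n → Bool) (h : ℕ → ℕ → Bool) →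
    Pr n p (λ D → h (count P (arcs D)) (count (not ∘ P) (arcs D)))
      ≡ expectCounts (offDiag n) P (λ a b → if h a b then 1ℚ else 0ℚ)
  Pr≡expectCounts {n} P h =
    trans (∑-map (allBoolVecs (length (offDiag n))) (mkDigraph {n}) (weightOn E))
          (∑-cong (allBoolVecs (length (offDiag n))) (λ {v} _ → mass v))
    where
    E : Digraph n → Bool
    E D = h (count P (arcs D)) (count (not ∘ P) (arcs D))

    mass : ∀ v → weightOn E (mkDigraph {n} v)
      ≡ bernoulli v * (if h (count P (select (offDiag n) v)) (count (not ∘ P) (select (offDiag n) v)) then 1ℚ else 0ℚ)
    mass v rewrite weight≡bernoulli (mkDigraph {n} v)
      with h (count P (select (offDiag n) v)) (count (not ∘ P) (select (offDiag n) v))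
    ... | true = sym (ℚₚ.*-identityʳ (bernoulli v))
    ... | false = sym (ℚₚ.*-zeroʳ (bernoulli v))

  Pr-renumbering-invariant : ∀ {n} {f : Fin n → Fin n} → Injective _≡_ _≡_ f → (h : ℕ → ℕ → Bool) →
    Pr n p (λ D → h (count (rises f) (arcs D)) (count (rises f ∘ swap) (arcs D))) ≡ Pr n p (λ D → h (Xof D) (Yof D))
  Pr-renumbering-invariant {n} {f} f-injective h = begin
    Pr n p (λ D → h (count (rises f) (arcs D)) (count (rises f ∘ swap) (arcs D)))   ≡⟨ Pr-cong (falls f-injective) ⟩
    Pr n p (λ D → h (count (rises f) (arcs D)) (count (not ∘ rises f) (arcs D)))    ≡⟨ Pr≡expectCounts (rises f) h ⟩
    expectCounts (offDiag n) (rises f) 𝟙h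
      ≡⟨ expectCounts-cong (offDiag n) 𝟙h (count-rises-offDiag f-injective) ⟩
    expectCounts (offDiag n) (rises id) 𝟙h                                          ≡⟨ Pr≡expectCounts (rises {n} id) h ⟨
    Pr n p (λ D → h (count (rises id) (arcs D)) (count (not ∘ rises id) (arcs D)))  ≡⟨ Pr-cong (falls {g = id} id) ⟨
    Pr n p (λ D → h (Xof D) (Yof D))                                                ∎
    where
    open ≡-Reasoning
    𝟙h : ℕ → ℕ → ℚ
    𝟙h a b = if h a b then 1ℚ else 0ℚ

    falls : ∀ {g : Fin n → Fin n} → Injective _≡_ _≡_ g → (D : Digraph n) →
      h (count (rises g) (arcs D)) (count (rises g ∘ swap) (arcs D))
        ≡ h (count (rises g) (arcs D)) (count (not ∘ rises g) (arcs D))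
    falls g-injective D = cong (h _) (count-falls g-injective (arcs D) (arcs-loopless D))

module _ {n : ℕ} {p : ℚ} (0≤p : 0ℚ ≤ℚ p) (p≤1 : p ≤ℚ 1ℚ) where
  open Bernoulli p

  weightOn-nonNeg : (E : Digraph n → Bool) (D : Digraph n) → 0ℚ ≤ℚ weightOn E D
  weightOn-nonNeg E D with E D
  ... | true = subst (0ℚ ≤ℚ_) (sym (weight≡bernoulli D)) (bernoulli-nonNeg 0≤p p≤1 (arcPresent D))
  ... | false = ℚₚ.≤-refl

  Pr-nonNeg : (E : Digraph n → Bool) → 0ℚ ≤ℚ Pr n p E
  Pr-nonNeg E = ∑-nonNeg (allDigraphs n) (weightOn-nonNeg E)

  Pr-optimal≤∑Pr-renumbered : (h : ℕ → ℕ → Bool) →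
    Pr n p (λ D → h (Xstar D) (Ystar D))
      ≤ℚ ∑[ σ ∈ allRenumberings n ] Pr n p (λ D → h (feedforward σ D) (feedback σ D))
  Pr-optimal≤∑Pr-renumbered h = ℚₚ.≤-trans (∑-mono (allDigraphs n) union-bound)
    (ℚₚ.≤-reflexive (∑-comm (allDigraphs n) (allRenumberings n) λ D σ → weightOn (renumbered σ) D))
    where
    renumbered : Renumbering n → Digraph n → Bool
    renumbered σ D = h (feedforward σ D) (feedback σ D)

    union-bound : (D : Digraph n) →
      weightOn (λ D → h (Xstar D) (Ystar D)) D ≤ℚ ∑[ σ ∈ allRenumberings n ] weightOn (renumbered σ) D
    union-bound D with optimal-renumbering D
    ... | σ , σ∈ , X*≡ , Y*≡ rewrite X*≡ | Y*≡ = ∈⇒≤∑ (λ τ → weightOn-nonNeg (renumbered τ) D) σ∈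

lemma2p1 : (n : ℕ) → 1 ≤ n → (p r : ℚ) → 0ℚ < p → p < 1ℚ → 1ℚ ≤ℚ r →
    Pr n p (λ D → ratioGe (Xstar D) (Ystar D) r)
      ≤ℚ ℕtoℚ (n !) * Pr n p (λ D → ratioGe (Xof D) (Yof D) r)
lemma2p1 n _ p r 0<p p<1 _ = begin
  Pr n p (λ D → ratioGe (Xstar D) (Ystar D) r)
    ≤⟨ Pr-optimal≤∑Pr-renumbered {n} 0≤p p≤1 ratio≥r ⟩
  ∑[ σ ∈ allRenumberings n ] Pr n p (λ D → ratioGe (feedforward σ D) (feedback σ D) r)
    ≡⟨ ∑-cong (allRenumberings n) (λ {σ} σ∈ →
         Bernoulli.Pr-renumbering-invariant p (Equivalence.to (∈-allRenumberings σ) σ∈) ratio≥r) ⟩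
  ∑[ σ ∈ allRenumberings n ] Pr n p (λ D → ratioGe (Xof D) (Yof D) r)
    ≡⟨ ∑-const (allRenumberings n) _ ⟩
  ℕtoℚ (length (allRenumberings n)) * Pr n p (λ D → ratioGe (Xof D) (Yof D) r)
    ≤⟨ ℚₚ.*-monoʳ-≤-nonNeg _ {{ℚ.nonNegative (Pr-nonNeg {n} 0≤p p≤1 _)}} (ℕtoℚ-mono (length-allRenumberings n)) ⟩
  ℕtoℚ (n !) * Pr n p (λ D → ratioGe (Xof D) (Yof D) r)
    ∎
  where
  open ℚₚ.≤-Reasoning
  0≤p : 0ℚ ≤ℚ p
  0≤p = ℚₚ.<⇒≤ 0<p
  p≤1 : p ≤ℚ 1ℚ
  p≤1 = ℚₚ.<⇒≤ p<1
  ratio≥r : ℕ → ℕ → Bool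
  ratio≥r a b = ratioGe a b r
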